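{- Let $m,r$ be positive integers with $2<r\le m/2$. Then $u_r+u_{m-r}\ge u_1+u_{m-1}$. If in addition none of the numbers $m-4,m-3,m-2,m-1$ is triangular, then $u_r+u_{m-r}\ge 1+u_1+u_{m-1}$.
   Context: For integers $k\ge0$, $t_k=\binom{k+1}{2}$; a triangular number is $t_k$ for some integer $k\ge1$. For an integer $r\ge0$, $u_r=\max\{k\ge0: t_k\le r\}$. -}

module Defs where

open import Data.Nat using (ℕ; zero; suc; _+_; _≤_; _≤?_; _<_)
open import Data.Nat.Combinatorics using (_C_)
open import Data.Product using (Σ; _×_)
open import Relation.Binary.PropositionalEquality using (_≡_)
open import Relation.Nullary using (yes; no)

t : ℕ → ℕ
t k = suc k C 2

Triangular : ℕ → Set
Triangular n = Σ ℕ λ k → (1 ≤ k) × (t k ≡ n)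

uSearch : ℕ → ℕ → ℕ
uSearch r zero = zero
uSearch r (suc b) with t (suc b) ≤? r
... | yes _ = suc b
... | no _ = uSearch r b

-- u r = max { k ≥ 0 : t k ≤ r }; since t k ≥ k, the max is ≤ r
u : ℕ → ℕ
u r = uSearch r r

-- Write x = u r and y = u (m − r), both at least 2 since r > 2.  Then m + 2 ≤ t (x + 1) + t (y + 1),
-- and the identity t (x + 1) + t (y + 1) + (x − 2)(y − 2) = t (x + y − 1) + 6 gives
-- m ≤ t (x + y − 1) + 4 ≤ t (x + y), so u (m − 1) < x + y.  If moreover t (x + y − 1) ≤ m − 1,
-- then m − t (x + y − 1) ∈ {1, 2, 3, 4} and one of m − 1, …, m − 4 is the triangular number
-- t (x + y − 1); otherwise u (m − 1) < x + y − 1.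
module Submission where

open import Defs
open import Data.Nat using (ℕ; zero; suc; _+_; _∸_; _*_; _≤_; _<_; _≤?_; z≤n; s≤s)
open import Data.Nat.Properties
open import Data.Nat.Combinatorics using (_C_; nC1≡n; nCk+nC[k+1]≡[n+1]C[k+1])
open import Data.Nat.Solver using (module +-*-Solver)
open import Data.Product using (_×_; _,_)
open import Data.Empty using (⊥-elim)
open import Relation.Nullary using (¬_; yes; no)
open import Relation.Binary.PropositionalEquality

open +-*-Solver

t-suc : ∀ k → t (suc k) ≡ suc k + t k
t-suc k = begin
    suc (suc k) C 2
  ≡⟨ nCk+nC[k+1]≡[n+1]C[k+1] (suc k) 1 ⟨
    suc k C 1 + t k
  ≡⟨ cong (_+ t k) (nC1≡n (suc k)) ⟩
    suc k + t k ∎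
  where open ≡-Reasoning

t-mono-≤ : ∀ {k l} → k ≤ l → t k ≤ t l
t-mono-≤ {zero} _ = z≤n
t-mono-≤ {suc k} {suc l} (s≤s k≤l) = begin
    t (suc k)     ≡⟨ t-suc k ⟩
    suc k + t k   ≤⟨ +-mono-≤ (s≤s k≤l) (t-mono-≤ k≤l) ⟩
    suc l + t l   ≡⟨ t-suc l ⟨
    t (suc l)     ∎
  where open ≤-Reasoning

t-+ : ∀ a b → t (a + b) ≡ t a + t b + a * b
t-+ zero b = sym (+-identityʳ (t b))
t-+ (suc a) b = begin
    t (suc (a + b))
  ≡⟨ t-suc (a + b) ⟩
    suc (a + b) + t (a + b)
  ≡⟨ cong (suc (a + b) +_) (t-+ a b) ⟩
    suc (a + b) + (t a + t b + a * b)
  ≡⟨ solve 4 (λ a b ta tb → (con 1 :+ (a :+ b)) :+ (ta :+ tb :+ a :* b)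
                   := (con 1 :+ a :+ ta) :+ tb :+ (con 1 :+ a) :* b) refl a b (t a) (t b) ⟩
    (suc a + t a) + t b + suc a * b
  ≡⟨ cong (λ z → z + t b + suc a * b) (t-suc a) ⟨
    t (suc a) + t b + suc a * b ∎
  where open ≡-Reasoning

t[3+p]+t[3+q]+p*q≡t[3+p+q]+6 : ∀ p q → t (3 + p) + t (3 + q) + p * q ≡ t (3 + p + q) + 6
t[3+p]+t[3+q]+p*q≡t[3+p+q]+6 p q = begin
    t (3 + p) + t (3 + q) + p * q
  ≡⟨ cong (λ z → t (3 + p) + z + p * q) (t-+ 3 q) ⟩
    t (3 + p) + (6 + t q + 3 * q) + p * q
  ≡⟨ solve 4 (λ tp tq p q → tp :+ (con 6 :+ tq :+ con 3 :* q) :+ p :* q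
                       := tp :+ tq :+ (con 3 :+ p) :* q :+ con 6) refl (t (3 + p)) (t q) p q ⟩
    t (3 + p) + t q + (3 + p) * q + 6
  ≡⟨ cong (_+ 6) (t-+ (3 + p) q) ⟨
    t (3 + p + q) + 6 ∎
  where open ≡-Reasoning

t[uSearch]≤r : ∀ r b → t (uSearch r b) ≤ r
t[uSearch]≤r r zero = z≤n
t[uSearch]≤r r (suc b) with t (suc b) ≤? r
... | yes t[1+b]≤r = t[1+b]≤r
... | no _ = t[uSearch]≤r r b

r<t[1+uSearch] : ∀ r b → r < t (suc b) → r < t (suc (uSearch r b))
r<t[1+uSearch] r zero r<t[1] = r<t[1]
r<t[1+uSearch] r (suc b) r<t[2+b] with t (suc b) ≤? r
... | yes _ = r<t[2+b]
... | no t[1+b]≰r = r<t[1+uSearch] r b (≰⇒> t[1+b]≰r)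

t[u[r]]≤r : ∀ r → t (u r) ≤ r
t[u[r]]≤r r = t[uSearch]≤r r r

r<t[1+u[r]] : ∀ r → r < t (suc (u r))
r<t[1+u[r]] r = r<t[1+uSearch] r r (subst (r <_) (sym (t-suc r)) (s≤s (m≤m+n r (t r))))

t[k]≤r⇒k≤u[r] : ∀ {k r} → t k ≤ r → k ≤ u r
t[k]≤r⇒k≤u[r] {k} {r} t[k]≤r with k ≤? u r
... | yes k≤u[r] = k≤u[r]
... | no k≰u[r] = ⊥-elim (<⇒≱ (r<t[1+u[r]] r) (≤-trans (t-mono-≤ (≰⇒> k≰u[r])) t[k]≤r))

r<t[k]⇒u[r]<k : ∀ {k r} → r < t k → u r < k
r<t[k]⇒u[r]<k {k} {r} r<t[k] with suc (u r) ≤? k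
... | yes u[r]<k = u[r]<k
... | no u[r]≮k = ⊥-elim (<⇒≱ r<t[k] (≤-trans (t-mono-≤ (≤-pred (≰⇒> u[r]≮k))) (t[u[r]]≤r r)))

4≤u[r]+u[s] : ∀ {r s} → 2 < r → 2 < s → 4 ≤ u r + u s
4≤u[r]+u[s] 2<r 2<s = +-mono-≤ (t[k]≤r⇒k≤u[r] {2} 2<r) (t[k]≤r⇒k≤u[r] {2} 2<s)

r+s≤t[u[r]+u[s]∸1]+4 : ∀ {r s} → 2 < r → 2 < s → r + s ≤ t (u r + u s ∸ 1) + 4
r+s≤t[u[r]+u[s]∸1]+4 {r} {s} 2<r 2<s = begin
    r + s                   ≤⟨ +-cancelʳ-≤ 2 (r + s) _ r+s+2≤ ⟩
    t (3 + p + q) + 4       ≡⟨ cong (λ z → t z + 4) (cong (_∸ 1) u-sum) ⟨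
    t (u r + u s ∸ 1) + 4   ∎
  where
  open ≤-Reasoning
  p q : ℕ
  p = u r ∸ 2
  q = u s ∸ 2
  u[r]≡ : u r ≡ 2 + p
  u[r]≡ = sym (m+[n∸m]≡n (t[k]≤r⇒k≤u[r] {2} 2<r))
  u[s]≡ : u s ≡ 2 + q
  u[s]≡ = sym (m+[n∸m]≡n (t[k]≤r⇒k≤u[r] {2} 2<s))
  u-sum : u r + u s ≡ 4 + p + q
  u-sum = trans (cong₂ _+_ u[r]≡ u[s]≡)
    (solve 2 (λ p q → (con 2 :+ p) :+ (con 2 :+ q) := con 4 :+ p :+ q) refl p q)
  r+s+2≤ : r + s + 2 ≤ t (3 + p + q) + 4 + 2
  r+s+2≤ = begin
      r + s + 2                     ≡⟨ solve 2 (λ r s → r :+ s :+ con 2 := (con 1 :+ r) :+ (con 1 :+ s)) refl r s ⟩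
      suc r + suc s                 ≤⟨ +-mono-≤ (subst (λ z → r < t (suc z)) u[r]≡ (r<t[1+u[r]] r))
                                                (subst (λ z → s < t (suc z)) u[s]≡ (r<t[1+u[r]] s)) ⟩
      t (3 + p) + t (3 + q)         ≤⟨ m≤m+n _ (p * q) ⟩
      t (3 + p) + t (3 + q) + p * q ≡⟨ t[3+p]+t[3+q]+p*q≡t[3+p+q]+6 p q ⟩
      t (3 + p + q) + 6             ≡⟨ +-assoc (t (3 + p + q)) 4 2 ⟨
      t (3 + p + q) + 4 + 2         ∎

u[m∸1]<n : ∀ {m n} → 4 ≤ n → m ≤ t (n ∸ 1) + 4 → u (m ∸ 1) < n
u[m∸1]<n {zero} 4≤n _ = ≤-trans (s≤s z≤n) 4≤n
u[m∸1]<n {suc m} {suc k} (s≤s 3≤k) m<t[k]+4 = r<t[k]⇒u[r]<k (begin-strict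
    m            <⟨ m<t[k]+4 ⟩
    t k + 4      ≡⟨ +-comm (t k) 4 ⟩
    4 + t k      ≤⟨ +-monoˡ-≤ (t k) (s≤s 3≤k) ⟩
    suc k + t k  ≡⟨ t-suc k ⟨
    t (suc k)    ∎)
  where open ≤-Reasoning

¬Triangular[m∸d] : ∀ {m} d → 1 ≤ d → d ≤ 4 →
  ¬ Triangular (m ∸ 4) → ¬ Triangular (m ∸ 3) → ¬ Triangular (m ∸ 2) → ¬ Triangular (m ∸ 1) →
  ¬ Triangular (m ∸ d)
¬Triangular[m∸d] 1 _ _ _ _ _ ¬T1 = ¬T1
¬Triangular[m∸d] 2 _ _ _ _ ¬T2 _ = ¬T2
¬Triangular[m∸d] 3 _ _ _ ¬T3 _ _ = ¬T3
¬Triangular[m∸d] 4 _ _ ¬T4 _ _ _ = ¬T4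
¬Triangular[m∸d] (suc (suc (suc (suc (suc _))))) _ (s≤s (s≤s (s≤s (s≤s ()))))

1+u[m∸1]<n : ∀ {m n} → 2 ≤ n → m ≤ t (n ∸ 1) + 4 →
  ¬ Triangular (m ∸ 4) → ¬ Triangular (m ∸ 3) → ¬ Triangular (m ∸ 2) → ¬ Triangular (m ∸ 1) →
  suc (u (m ∸ 1)) < n
1+u[m∸1]<n {zero} 2≤n _ _ _ _ _ = 2≤n
1+u[m∸1]<n {suc m} {suc k} (s≤s 1≤k) m≤t[k]+4 ¬T4 ¬T3 ¬T2 ¬T1 with t k ≤? m
... | no t[k]≰m = s≤s (r<t[k]⇒u[r]<k (≰⇒> t[k]≰m))
... | yes t[k]≤m = ⊥-elim (¬Triangular[m∸d] {suc m} d (m<n⇒0<n∸m (s≤s t[k]≤m))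
                             (m≤n+o⇒m∸n≤o (suc m) (t k) m≤t[k]+4) ¬T4 ¬T3 ¬T2 ¬T1
                             (k , 1≤k , sym (m∸[m∸n]≡n (m≤n⇒m≤1+n t[k]≤m))))
  where
  d : ℕ
  d = suc m ∸ t k

2*r≤m⇒r≤m∸r : ∀ {m r} → 2 * r ≤ m → r ≤ m ∸ r
2*r≤m⇒r≤m∸r {m} {r} 2r≤m = m+n≤o⇒m≤o∸n r (subst (_≤ m) (cong (r +_) (+-identityʳ r)) 2r≤m)

lemma4p2 : (m r : ℕ) → 2 < r → 2 * r ≤ m →
    (u 1 + u (m ∸ 1) ≤ u r + u (m ∸ r))
    × (¬ Triangular (m ∸ 4) → ¬ Triangular (m ∸ 3) → ¬ Triangular (m ∸ 2) → ¬ Triangular (m ∸ 1)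
    → 1 + u 1 + u (m ∸ 1) ≤ u r + u (m ∸ r))
-- u 1 computes to 1, so both goals are strict bounds on u (m ∸ 1).
lemma4p2 m r 2<r 2r≤m =
  u[m∸1]<n 4≤n m≤t[n∸1]+4 , 1+u[m∸1]<n (≤-trans (s≤s (s≤s z≤n)) 4≤n) m≤t[n∸1]+4
  where
  2<m∸r : 2 < m ∸ r
  2<m∸r = ≤-trans 2<r (2*r≤m⇒r≤m∸r 2r≤m)
  4≤n : 4 ≤ u r + u (m ∸ r)
  4≤n = 4≤u[r]+u[s] 2<r 2<m∸r
  m≤t[n∸1]+4 : m ≤ t (u r + u (m ∸ r) ∸ 1) + 4
  m≤t[n∸1]+4 = ≤-trans (m≤n+m∸n m r) (r+s≤t[u[r]+u[s]∸1]+4 2<r 2<m∸r)
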